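{- Let $G,H$ be graphs and $v\in V(G)$ a vertex such that there is a fold $\rho:G\to G$ with image $G\setminus\{v\}$ (i.e. $\rho(v)\neq v$). Then $G\times H$ is homotopy equivalent to $(G\setminus\{v\})\times H$.
   Context: A graph is a finite undirected graph, loops allowed, at most one edge between two vertices; a graph morphism is a vertex map preserving edges. $G\setminus\{v\}$ is the induced subgraph of $G$ on $V(G)\setminus\{v\}$. The product $G\times H$ has vertex set $V(G)\times V(H)$ and $(v_1,w_1)\text{ --- }(v_2,w_2)$ iff $v_1\text{ --- }v_2$ in $G$ and $w_1\text{ --- }w_2$ in $H$. Two morphisms $f,g:G\to H$ form a spider pair if there is a single vertex $x$ with $f(y)=g(y)$ for all $y\neq x$ and, if $x$ is looped, $f(x)\text{ --- }g(x)$; a fold is a morphism $f:G\to G$ such that $f$ and $\mathrm{id}_G$ form a spider pair. The exponential graph $H^G$ has as vertices the set maps $V(G)\to V(H)$, with $f\text{ --- }g$ iff $f(v_1)\text{ --- }g(v_2)$ for every edge $v_1\text{ --- }v_2$ of $G$. Morphisms are homotopic if joined by a sequence of morphisms consecutive ones adjacent in $H^G$; graphs $G,H$ are homotopy equivalent if there are morphisms $f:G\to H$, $g:H\to G$ with $gf$, $fg$ homotopic to the identities. -}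

module Defs where

open import Level using (0ℓ)
open import Data.Bool using (Bool; T; _∧_)
open import Data.Nat using (ℕ)
open import Data.Fin using (Fin)
open import Data.Product using (Σ; _×_; _,_; proj₁; proj₂; ∃)
open import Relation.Nullary using (¬_)
open import Relation.Binary.PropositionalEquality using (_≡_; _≢_)
open import Relation.Binary.Construct.Closure.ReflexiveTransitive using (Star)
open import Function.Bundles using (_↔_)

-- A graph: a vertex set with a symmetric Bool-valued adjacency relation
-- (loops allowed, at most one edge between two vertices).
record Graph : Set₁ where
  field
    V   : Set
    adj : V → V → Bool
    sym : ∀ x y → adj x y ≡ adj y x

open Graph public

Edge : (G : Graph) → V G → V G → Set
Edge G x y = T (adj G x y)

Finite : Graph → Set
Finite G = Σ ℕ λ n → Fin n ↔ V G

record Hom (G H : Graph) : Set where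
  field
    map  : V G → V H
    pres : ∀ {x y} → Edge G x y → Edge H (map x) (map y)

open Hom public

idHom : (G : Graph) → Hom G G
idHom G = record { map = λ x → x ; pres = λ e → e }

_∘H_ : {G H K : Graph} → Hom H K → Hom G H → Hom G K
g ∘H f = record { map = λ x → map g (map f x) ; pres = λ e → pres g (pres f e) }

SpiderPair : {G H : Graph} → Hom G H → Hom G H → Set
SpiderPair {G} {H} f g =
  ∃ λ (x : V G) → (∀ y → y ≢ x → map f y ≡ map g y)
                × (Edge G x x → Edge H (map f x) (map g x))

IsFold : {G : Graph} → Hom G G → Set
IsFold {G} ρ = SpiderPair ρ (idHom G)

deleteVertex : (G : Graph) → V G → Graph
deleteVertex G v = record
  { V   = Σ (V G) (λ x → x ≢ v)
  ; adj = λ x y → adj G (proj₁ x) (proj₁ y)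
  ; sym = λ x y → sym G (proj₁ x) (proj₁ y)
  }

_×G_ : Graph → Graph → Graph
G ×G H = record
  { V   = V G × V H
  ; adj = λ p q → adj G (proj₁ p) (proj₁ q) ∧ adj H (proj₂ p) (proj₂ q)
  ; sym = λ p q → sym∧ (sym G (proj₁ p) (proj₁ q)) (sym H (proj₂ p) (proj₂ q))
  }
  where
  sym∧ : ∀ {a b c d : Bool} → a ≡ b → c ≡ d → (a ∧ c) ≡ (b ∧ d)
  sym∧ _≡_.refl _≡_.refl = _≡_.refl

-- adjacency in the exponential graph H^G (restricted to morphisms)
ExpAdj : {G H : Graph} → Hom G H → Hom G H → Set
ExpAdj {G} {H} f g = ∀ {x y} → Edge G x y → Edge H (map f x) (map g y)

Homotopic : {G H : Graph} → Hom G H → Hom G H → Set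
Homotopic = Star ExpAdj

HomotopyEquivalent : Graph → Graph → Set
HomotopyEquivalent G H =
  Σ (Hom G H) λ f → Σ (Hom H G) λ g →
    Homotopic (g ∘H f) (idHom G) × Homotopic (f ∘H g) (idHom H)

module Submission where

-- Let ρ be a fold of G whose centre vertex x is moved
-- (ρ v ≢ v).  Then x = v, ρ never hits v, so ρ corestricts to a retraction
-- r : G → G \ {v} of the inclusion ι : G \ {v} → G, with ι ∘ r = ρ.
--
-- The only homotopical input is that a spider pair f, g is adjacent in the
-- exponential graph (a one-step homotopy); in particular ρ ~ id_G.  As
-- edges of G \ {v} are edges of G, precomposing with ι turns ρ ~ id_G into
-- r ∘ ι ~ id.  Finally adjacency in the exponential graph is preserved by
-- taking the product with the identity of H, so r × id_H and ι × id_H are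
-- mutually inverse homotopy equivalences between G × H and (G \ {v}) × H.
--
-- Finiteness of G is used only to decide equality of vertices, which the
-- case analysis of the spider-pair lemma needs; finiteness of H is unused.

open import Defs
open import Data.Bool.Properties using (T-∧)
open import Data.Nat using (ℕ)
open import Data.Fin using (Fin)
open import Data.Product using (Σ; _,_; proj₁; proj₂)
open import Data.Fin.Properties using (inj⇒≟)
open import Function.Bundles using (Equivalence; _↔_)
open import Function.Properties.Inverse using (↔-sym; ↔⇒↣)
open import Relation.Binary.Definitions using (DecidableEquality)
open import Relation.Binary.PropositionalEquality
  using (_≡_; _≢_; refl; trans; subst) renaming (sym to ≡-sym)
open import Relation.Binary.Construct.Closure.ReflexiveTransitive using (ε; _◅_)
open import Relation.Nullary using (yes; no)
open import Data.Empty using (⊥-elim)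

finite⇒decEq : {A : Set} → Σ ℕ (λ n → Fin n ↔ A) → DecidableEquality A
finite⇒decEq (_ , fin↔A) = inj⇒≟ (↔⇒↣ (↔-sym fin↔A))

×-edge : {G H : Graph} {a b : V G} {h k : V H} →
         Edge G a b → Edge H h k → Edge (G ×G H) (a , h) (b , k)
×-edge e e′ = Equivalence.from T-∧ (e , e′)

×-edge₁ : {G H : Graph} {p q : V (G ×G H)} →
          Edge (G ×G H) p q → Edge G (proj₁ p) (proj₁ q)
×-edge₁ e = proj₁ (Equivalence.to T-∧ e)

×-edge₂ : {G H : Graph} {p q : V (G ×G H)} →
          Edge (G ×G H) p q → Edge H (proj₂ p) (proj₂ q)
×-edge₂ e = proj₂ (Equivalence.to T-∧ e)

_×id_ : {G G′ : Graph} → Hom G G′ → (H : Graph) → Hom (G ×G H) (G′ ×G H)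
_×id_ {G} {G′} f H = record
  { map  = λ p → map f (proj₁ p) , proj₂ p
  ; pres = λ e → ×-edge {G′} {H} (pres f (×-edge₁ {G} {H} e))
                                 (×-edge₂ {G} {H} e) }

-- A spider pair is adjacent in the exponential graph H^G: away from the
-- centre x the two maps agree, and at x the loop condition applies.
spider⇒adjacent : {G H : Graph} → DecidableEquality (V G) →
                  {f g : Hom G H} → SpiderPair f g → ExpAdj f g
spider⇒adjacent {H = H} _≟_ {f} {g} (x , agree , loop) {a} {b} e
  with a ≟ x | b ≟ x
... | no a≢x | _ = subst (λ z → Edge H z (map g b)) (≡-sym (agree a a≢x)) (pres g e)
... | yes refl | no b≢x = subst (λ z → Edge H (map f a) z) (agree b b≢x) (pres f e)
... | yes refl | yes refl = loop e

spider-centre : {G H : Graph} → DecidableEquality (V G) →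
                {f g : Hom G H} → (s : SpiderPair f g) →
                {y : V G} → map f y ≢ map g y → y ≡ proj₁ s
spider-centre _≟_ (x , agree , _) {y} fy≢gy with y ≟ x
... | yes y≡x = y≡x
... | no y≢x  = ⊥-elim (fy≢gy (agree y y≢x))

-- A fold that moves v fixes every other vertex, hence never takes the value v.
fold-avoids : {G : Graph} → DecidableEquality (V G) →
              {ρ : Hom G G} → IsFold ρ → {v : V G} → map ρ v ≢ v →
              ∀ a → map ρ a ≢ v
fold-avoids {G} _≟_ {ρ} fold@(x , agree , _) {v} ρv≢v a ρa≡v with a ≟ v
... | yes refl = ρv≢v ρa≡v
... | no a≢v   = a≢v (subst (_≡ v) (agree a a≢x) ρa≡v)
  where
  -- v is moved, so it is the centre of the fold
  v≡x : v ≡ x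
  v≡x = spider-centre _≟_ {ρ} {idHom G} fold ρv≢v
  a≢x : a ≢ x
  a≢x a≡x = a≢v (trans a≡x (≡-sym v≡x))

include : (G : Graph) (v : V G) → Hom (deleteVertex G v) G
include G v = record { map = proj₁ ; pres = λ e → e }

corestrict : {G : Graph} {v : V G} (ρ : Hom G G) → (∀ a → map ρ a ≢ v) →
             Hom G (deleteVertex G v)
corestrict ρ avoids = record { map = λ a → map ρ a , avoids a ; pres = pres ρ }

adjacent-∘ʳ : {K G H : Graph} {f g : Hom G H} (h : Hom K G) →
              ExpAdj f g → ExpAdj (f ∘H h) (g ∘H h)
adjacent-∘ʳ h f~g e = f~g (pres h e)

adjacent-×id : {G G′ : Graph} {f g : Hom G G′} (H : Graph) →
               ExpAdj f g → ExpAdj (f ×id H) (g ×id H)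
adjacent-×id {G} {G′} H f~g e =
  ×-edge {G′} {H} (f~g (×-edge₁ {G} {H} e)) (×-edge₂ {G} {H} e)

adjacent⇒homotopic : {G H : Graph} {f g : Hom G H} → ExpAdj f g → Homotopic f g
adjacent⇒homotopic f~g = f~g ◅ ε

lemma5p6 : (G H : Graph) → Finite G → Finite H → (v : V G) →
    (ρ : Hom G G) → IsFold ρ → map ρ v ≢ v →
    HomotopyEquivalent (G ×G H) (deleteVertex G v ×G H)
lemma5p6 G H finG _ v ρ fold ρv≢v =
  r ×id H , ι ×id H ,
  adjacent⇒homotopic {f = (ι ×id H) ∘H (r ×id H)} ι∘r×id~id ,
  adjacent⇒homotopic {f = (r ×id H) ∘H (ι ×id H)} (λ {p} {q} → r∘ι×id~id {p} {q})
  where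
  _≟_ : DecidableEquality (V G)
  _≟_ = finite⇒decEq finG
  ρ~id : ExpAdj ρ (idHom G)
  ρ~id = spider⇒adjacent _≟_ {ρ} {idHom G} fold
  ι : Hom (deleteVertex G v) G
  ι = include G v
  r : Hom G (deleteVertex G v)
  r = corestrict ρ (fold-avoids _≟_ {ρ} fold ρv≢v)
  -- Edges of G \ {v} are edges of G, so restricting ρ ~ id along ι gives
  -- r ∘ ι ~ id.  (Vertices of G \ {v} are not determined by their edges'
  -- types, hence the explicit implicit arguments.)
  r∘ι~id : ExpAdj (r ∘H ι) (idHom (deleteVertex G v))
  r∘ι~id {a} {b} = adjacent-∘ʳ {f = ρ} {g = idHom G} ι ρ~id {a} {b}
  ι∘r×id~id : ExpAdj ((ι ×id H) ∘H (r ×id H)) (idHom (G ×G H))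
  ι∘r×id~id = adjacent-×id {f = ρ} {g = idHom G} H ρ~id
  r∘ι×id~id : ExpAdj ((r ×id H) ∘H (ι ×id H)) (idHom (deleteVertex G v ×G H))
  r∘ι×id~id {p} {q} =
    adjacent-×id {f = r ∘H ι} {g = idHom (deleteVertex G v)} H
      (λ {a} {b} → r∘ι~id {a} {b}) {p} {q}
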